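{- For all integers $n,m \geq 5$, $\gamma_p(KN_{n,m}) = nm$; that is, the only perfect dominating set of the knights graph $KN_{n,m}$ is its whole vertex set.
   Context: For a graph $G=(V,E)$, a set $S\subseteq V$ is a perfect dominating set if every vertex $v\in V\setminus S$ is adjacent to exactly one vertex of $S$. The perfect domination number $\gamma_p(G)$ is the minimum cardinality of a perfect dominating set of $G$. The knights graph $KN_{n,m}$ has vertex set $\{(i,j): 1\le i\le n,\ 1\le j\le m\}$ (squares of a chessboard with $n$ columns and $m$ rows, $(i,j)$ being column $i$, row $j$), and $(a,b)$ is adjacent to $(c,d)$ iff $\{|a-c|,|b-d|\}=\{1,2\}$ (a knight's move). -}

module Defs where

open import Data.Nat using (ℕ; _≤_; ∣_-_∣)
open import Data.Nat.Properties using (_≟_)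
open import Data.Fin using (Fin; toℕ)
open import Data.Fin.Properties using () renaming (_≟_ to _≟ᶠ_)
open import Data.Bool using (Bool; true; false)
open import Data.Bool.Properties using () renaming (_≟_ to _≟ᵇ_)
open import Data.List using (List; allFin; cartesianProduct; filter; length)
open import Data.Product using (_×_; _,_; Σ)
open import Data.Sum using (_⊎_)
open import Relation.Binary.PropositionalEquality using (_≡_)
open import Relation.Nullary using (Dec)
open import Relation.Nullary.Decidable using (_×-dec_; _⊎-dec_)

-- Squares of the n-column, m-row board: (column i, row j), 0-indexed.
Square : ℕ → ℕ → Set
Square n m = Fin n × Fin m

squares : (n m : ℕ) → List (Square n m)
squares n m = cartesianProduct (allFin n) (allFin m)

KnightAdj : {n m : ℕ} → Square n m → Square n m → Set
KnightAdj (a , b) (c , d) =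
  (∣ toℕ a - toℕ c ∣ ≡ 1 × ∣ toℕ b - toℕ d ∣ ≡ 2) ⊎
  (∣ toℕ a - toℕ c ∣ ≡ 2 × ∣ toℕ b - toℕ d ∣ ≡ 1)

knightAdj? : {n m : ℕ} (u v : Square n m) → Dec (KnightAdj u v)
knightAdj? (a , b) (c , d) =
  ((∣ toℕ a - toℕ c ∣ ≟ 1) ×-dec (∣ toℕ b - toℕ d ∣ ≟ 2)) ⊎-dec
  ((∣ toℕ a - toℕ c ∣ ≟ 2) ×-dec (∣ toℕ b - toℕ d ∣ ≟ 1))

VSet : ℕ → ℕ → Set
VSet n m = Square n m → Bool

card : {n m : ℕ} → VSet n m → ℕ
card {n} {m} S = length (filter (λ v → S v ≟ᵇ true) (squares n m))

neighboursIn : {n m : ℕ} → VSet n m → Square n m → List (Square n m)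
neighboursIn {n} {m} S v =
  filter (λ u → knightAdj? v u ×-dec (S u ≟ᵇ true)) (squares n m)

IsPerfectDominating : {n m : ℕ} → VSet n m → Set
IsPerfectDominating {n} {m} S =
  (v : Square n m) → S v ≡ false → length (neighboursIn S v) ≡ 1

IsPerfectDominationNumber : ℕ → ℕ → ℕ → Set
IsPerfectDominationNumber n m k =
  Σ (VSet n m) (λ S → IsPerfectDominating S × card S ≡ k) ×
  ((S : VSet n m) → IsPerfectDominating S → k ≤ card S)

module Submission where

-- A square outside a perfect dominating set S has exactly one knight
-- neighbour in S, so a square with two distinct neighbours in S lies in S.
-- A search over all subsets of a corner window (the whole board side when it
-- has length 5 or 6, seven squares of it otherwise), pruned by the
-- exactly-one constraints of the squares whose neighbourhood the window
-- contains, shows that the window lies in S. From its bottom two rows the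
-- two-neighbour rule fills the strip of the first five columns row by row,
-- and from the first two columns it fills the board column by column.

open import Defs
open import Data.Bool using (Bool; true; false; _∧_; _∨_; not; if_then_else_; T)
open import Data.Bool.Properties using (T-∧; T-∨; T-≡) renaming (_≟_ to _≟ᵇ_)
open import Data.Bool.ListAction using (any; all)
open import Data.Empty using (⊥-elim)
open import Data.Fin using (toℕ; fromℕ<)
open import Data.Fin.Properties using (toℕ<n; toℕ-fromℕ<; fromℕ<-toℕ)
open import Data.List
  using (List; []; _∷_; _++_; length; map; filter; upTo; concatMap; cartesianProduct; allFin)
open import Data.List.Properties using (length-++; length-map; length-tabulate; filter-all)
open import Data.List.Membership.Propositional using (_∈_; find; lose)
open import Data.List.Membership.Propositional.Properties
  using ( ∈-filter⁺; ∈-filter⁻; ∈-cartesianProduct⁺; ∈-concatMap⁺; ∈-upTo⁺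
        ; ∈-++⁺ˡ; ∈-++⁺ʳ; ∈-allFin)
open import Data.List.Relation.Unary.All as All using (All; []; _∷_)
open import Data.List.Relation.Unary.All.Properties using (all⁺; All¬⇒¬Any)
open import Data.List.Relation.Unary.Any using (Any; here; there)
open import Data.List.Relation.Unary.Any.Properties using (any⁻)
open import Data.Maybe using (Maybe; just; nothing)
open import Data.Maybe.Properties using (just-injective)
open import Data.Nat
  using ( ℕ; zero; suc; _+_; _*_; _∸_; _⊔_; _≤_; _<_; _≡ᵇ_; _≤ᵇ_; _<ᵇ_; ∣_-_∣
        ; z≤n; s≤s; _≟_; _<?_)
open import Data.Nat.Properties
  using ( ≤-refl; ≤-reflexive; ≤-trans; <-≤-trans; ≤-<-trans; +-mono-<; +-monoʳ-≤; +-comm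
        ; m≤m+n; m≤n+m; n≤1+n; m⊔n≤m+n; m+n∸n≡m; ≤⇒≤ᵇ; <ᵇ⇒<; ≡ᵇ⇒≡; ≡⇒≡ᵇ
        ; m≤n+∣n-m∣; ∣-∣-comm; ∣m-m+n∣≡n)
open import Data.Product using (_×_; _,_; proj₁; proj₂; ∃)
open import Data.Sum using (_⊎_; inj₁; inj₂)
import Data.Sum as Sum
open import Function using (Equivalence)
open import Relation.Binary.Definitions using (DecidableEquality)
open import Relation.Binary.PropositionalEquality
  using (_≡_; _≢_; refl; sym; trans; cong; cong₂; module ≡-Reasoning)
open import Relation.Nullary using (Dec; yes; no; _because_; ¬_; contradiction)
open import Relation.Nullary.Reflects using (fromEquivalence)
open import Relation.Nullary.Decidable
  using (⌊_⌋; _×-dec_; _⊎-dec_; toWitness; toWitnessFalse)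

T-∧⁻ : ∀ {x y} → T (x ∧ y) → T x × T y
T-∧⁻ {x} = Equivalence.to (T-∧ {x})

T-∨⁻ : ∀ {x y} → T (x ∨ y) → T x ⊎ T y
T-∨⁻ {x} = Equivalence.to (T-∨ {x})

length≡1⇒≡ : ∀ {A : Set} {xs : List A} {x y} → length xs ≡ 1 → x ∈ xs → y ∈ xs → x ≡ y
length≡1⇒≡ {xs = _ ∷ []} _ (here refl) (here refl) = refl

length≡1⇒∃∈ : ∀ {A : Set} {xs : List A} → length xs ≡ 1 → ∃ (_∈ xs)
length≡1⇒∃∈ {xs = x ∷ _} _ = x , here refl

length-cartesianProduct : ∀ {A B : Set} (xs : List A) (ys : List B) →
                          length (cartesianProduct xs ys) ≡ length xs * length ys
length-cartesianProduct []       ys = refl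
length-cartesianProduct (x ∷ xs) ys =
  trans (length-++ (map (x ,_) ys))
        (cong₂ _+_ (length-map (x ,_) ys) (length-cartesianProduct xs ys))

induction₂ : ∀ {P : ℕ → Set} → P 0 → P 1 → (∀ k → P k → P (1 + k) → P (2 + k)) →
             ∀ k → P k
induction₂ {P} p₀ p₁ step k = proj₁ (pairs k)
  where
  pairs : ∀ k → P k × P (1 + k)
  pairs zero    = p₀ , p₁
  pairs (suc k) = let pₖ , pₖ₊₁ = pairs k in pₖ₊₁ , step k pₖ pₖ₊₁

module ExactlyOneSearch {C : Set} (_≟ᶜ_ : DecidableEquality C)
                        (N : C → List C) (closed : C → Bool) where

  AtMostOne : (C → Bool) → List C → Set
  AtMostOne ρ xs = ∀ {x y} → x ∈ xs → y ∈ xs → ρ x ≡ true → ρ y ≡ true → x ≡ y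

  Satisfies : (C → Bool) → Set
  Satisfies ρ = ∀ c → ρ c ≡ false →
    AtMostOne ρ (N c) × (T (closed c) → Any (λ x → ρ x ≡ true) (N c))

  Assignment : Set
  Assignment = C → Maybe Bool

  unassigned : Assignment
  unassigned _ = nothing

  _[_≔_] : Assignment → C → Bool → Assignment
  (σ [ c ≔ b ]) x = if ⌊ x ≟ᶜ c ⌋ then just b else σ x

  infix 4 _⊑_
  _⊑_ : Assignment → (C → Bool) → Set
  σ ⊑ ρ = ∀ {c b} → σ c ≡ just b → ρ c ≡ b

  infix 7 _≐_
  _≐_ : Maybe Bool → Bool → Bool
  just b′ ≐ b = ⌊ b′ ≟ᵇ b ⌋
  nothing ≐ _ = false

  twoTrue : Assignment → List C → Bool
  twoTrue σ []       = false
  twoTrue σ (x ∷ xs) =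
    σ x ≐ true ∧ any (λ y → σ y ≐ true ∧ not ⌊ y ≟ᶜ x ⌋) xs ∨ twoTrue σ xs

  violatedAt : Assignment → C → Bool
  violatedAt σ c =
    σ c ≐ false ∧ (twoTrue σ (N c) ∨ closed c ∧ all (λ x → σ x ≐ false) (N c))

  -- Assigning c can only break the constraints of c and of its neighbours.
  conflictNear : Assignment → C → Bool
  conflictNear σ c = any (violatedAt σ) (c ∷ N c)

  refutes : Assignment → C → List C → Bool
  refutes σ c []       = conflictNear σ c
  refutes σ c (d ∷ ds) = conflictNear σ c ∨
    (refutes (σ [ d ≔ false ]) d ds ∧ refutes (σ [ d ≔ true ]) d ds)

  forced : Assignment → List C → Bool
  forced σ []       = true
  forced σ (c ∷ cs) = refutes (σ [ c ≔ false ]) c cs ∧ forced (σ [ c ≔ true ]) cs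

  module _ {ρ : C → Bool} where

    ≐-⊑ : ∀ {σ c b} → σ ⊑ ρ → T (σ c ≐ b) → ρ c ≡ b
    ≐-⊑ {σ} {c} {b} σ⊑ρ t with σ c in eq
    ... | just b′ = trans (σ⊑ρ eq) (toWitness {a? = b′ ≟ᵇ b} t)

    ⊑-assign : ∀ {σ c b} → σ ⊑ ρ → ρ c ≡ b → σ [ c ≔ b ] ⊑ ρ
    ⊑-assign {c = c} σ⊑ρ ρc {x} eq with x ≟ᶜ c
    ... | yes refl = trans ρc (just-injective eq)
    ... | no _     = σ⊑ρ eq

    twoTrue-sound : ∀ {σ} xs → σ ⊑ ρ → T (twoTrue σ xs) → ¬ AtMostOne ρ xs
    twoTrue-sound {σ} (x ∷ xs) σ⊑ρ t amo with T-∨⁻ {σ x ≐ true ∧ _} t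
    ... | inj₂ t′ = twoTrue-sound xs σ⊑ρ t′ (λ x∈ y∈ → amo (there x∈) (there y∈))
    ... | inj₁ t′
      with x-true , some  ← T-∧⁻ {σ x ≐ true} t′
      with y , y∈ , y-ok  ← find (any⁻ _ xs some)
      with y-true , y≢x   ← T-∧⁻ {σ y ≐ true} y-ok
      = toWitnessFalse {a? = y ≟ᶜ x} y≢x
          (amo (there y∈) (here refl) (≐-⊑ σ⊑ρ y-true) (≐-⊑ σ⊑ρ x-true))

    allFalse-sound : ∀ {σ} xs → σ ⊑ ρ → T (all (λ x → σ x ≐ false) xs) →
                     ¬ Any (λ x → ρ x ≡ true) xs
    allFalse-sound {σ} xs σ⊑ρ t = All¬⇒¬Any (All.map false⇒¬true (all⁺ _ xs t))
      where
      false⇒¬true : ∀ {x} → T (σ x ≐ false) → ¬ ρ x ≡ true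
      false⇒¬true f ρx = contradiction (trans (sym ρx) (≐-⊑ σ⊑ρ f)) λ ()

    module _ (sat : Satisfies ρ) where

      violatedAt-sound : ∀ {σ} c → σ ⊑ ρ → ¬ T (violatedAt σ c)
      violatedAt-sound {σ} c σ⊑ρ t
        with c∉ , broken              ← T-∧⁻ {σ c ≐ false} t
        with atMostOne , atLeastOne   ← sat c (≐-⊑ σ⊑ρ c∉)
        with T-∨⁻ {twoTrue σ (N c)} broken
      ... | inj₁ two = twoTrue-sound (N c) σ⊑ρ two atMostOne
      ... | inj₂ closed-none with cl , none ← T-∧⁻ {closed c} closed-none
        = allFalse-sound (N c) σ⊑ρ none (atLeastOne cl)

      conflictNear-sound : ∀ {σ} c → σ ⊑ ρ → ¬ T (conflictNear σ c)
      conflictNear-sound c σ⊑ρ t with d , _ , v ← find (any⁻ _ (c ∷ N c) t) =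
        violatedAt-sound d σ⊑ρ v

      refutes-sound : ∀ {σ} c ds → σ ⊑ ρ → ¬ T (refutes σ c ds)
      refutes-sound c [] σ⊑ρ = conflictNear-sound c σ⊑ρ
      refutes-sound {σ} c (d ∷ ds) σ⊑ρ t with T-∨⁻ {conflictNear σ c} t
      ... | inj₁ t′ = conflictNear-sound c σ⊑ρ t′
      ... | inj₂ t′ with T-∧⁻ {refutes (σ [ d ≔ false ]) d ds} t′ | ρ d in ρd
      ...   | t-false , _ | false = refutes-sound d ds (⊑-assign σ⊑ρ ρd) t-false
      ...   | _ , t-true  | true  = refutes-sound d ds (⊑-assign σ⊑ρ ρd) t-true

      forced-sound : ∀ {σ} cs → σ ⊑ ρ → T (forced σ cs) → All (λ c → ρ c ≡ true) cs
      forced-sound []       _    _ = []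
      forced-sound {σ} (c ∷ cs) σ⊑ρ t
        with T-∧⁻ {refutes (σ [ c ≔ false ]) c cs} t | ρ c in ρc
      ... | t-false , _ | false = ⊥-elim (refutes-sound c cs (⊑-assign σ⊑ρ ρc) t-false)
      ... | _ , t-rest  | true  = ρc ∷ forced-sound cs (⊑-assign σ⊑ρ ρc) t-rest

Cell : Set
Cell = ℕ × ℕ

KnightMove : Cell → Cell → Set
KnightMove (i , j) (x , y) =
  (∣ i - x ∣ ≡ 1 × ∣ j - y ∣ ≡ 2) ⊎ (∣ i - x ∣ ≡ 2 × ∣ j - y ∣ ≡ 1)

knightMove? : ∀ c d → Dec (KnightMove c d)
knightMove? (i , j) (x , y) =
  ((∣ i - x ∣ ≟ 1) ×-dec (∣ j - y ∣ ≟ 2)) ⊎-dec ((∣ i - x ∣ ≟ 2) ×-dec (∣ j - y ∣ ≟ 1))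

-- Unlike Data.Product.Properties.≡-dec, the decision is a plain boolean,
-- which keeps the evaluation of the search fast.
_≟ᶜ_ : DecidableEquality Cell
(i , j) ≟ᶜ (x , y) = ((i ≡ᵇ x) ∧ (j ≡ᵇ y)) because fromEquivalence sound complete
  where
  sound : T ((i ≡ᵇ x) ∧ (j ≡ᵇ y)) → (i , j) ≡ (x , y)
  sound t with i≡x , j≡y ← T-∧⁻ {i ≡ᵇ x} t = cong₂ _,_ (≡ᵇ⇒≡ i x i≡x) (≡ᵇ⇒≡ j y j≡y)
  complete : (i , j) ≡ (x , y) → T ((i ≡ᵇ x) ∧ (j ≡ᵇ y))
  complete refl = Equivalence.from T-∧ (≡⇒≡ᵇ i i refl , ≡⇒≡ᵇ j j refl)

knightMove⇒∣-∣≤2 : ∀ {i j x y} → KnightMove (i , j) (x , y) → ∣ i - x ∣ ≤ 2 × ∣ j - y ∣ ≤ 2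
knightMove⇒∣-∣≤2 (inj₁ (e₁ , e₂)) = ≤-trans (≤-reflexive e₁) (n≤1+n 1) , ≤-reflexive e₂
knightMove⇒∣-∣≤2 (inj₂ (e₁ , e₂)) = ≤-reflexive e₁ , ≤-trans (≤-reflexive e₂) (n≤1+n 1)

∣m+n-n∣≡m : ∀ m n → ∣ m + n - n ∣ ≡ m
∣m+n-n∣≡m m n = trans (∣-∣-comm (m + n) n) (trans (cong (∣ n -_∣) (+-comm m n)) (∣m-m+n∣≡n n m))

∣m-n∣≡k⇒n≡m+k⊎m≡n+k : ∀ m n {k} → ∣ m - n ∣ ≡ k → n ≡ m + k ⊎ m ≡ n + k
∣m-n∣≡k⇒n≡m+k⊎m≡n+k zero    n       e = inj₁ e
∣m-n∣≡k⇒n≡m+k⊎m≡n+k (suc m) zero    e = inj₂ e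
∣m-n∣≡k⇒n≡m+k⊎m≡n+k (suc m) (suc n) e =
  Sum.map (cong suc) (cong suc) (∣m-n∣≡k⇒n≡m+k⊎m≡n+k m n e)

atDistance : ℕ → ℕ → List ℕ
atDistance k i = i + k ∷ (if k ≤ᵇ i then i ∸ k ∷ [] else [])

∈-atDistance : ∀ {i x k} → ∣ i - x ∣ ≡ k → x ∈ atDistance k i
∈-atDistance {i} {x} {k} e with ∣m-n∣≡k⇒n≡m+k⊎m≡n+k i x e
... | inj₁ refl = here refl
... | inj₂ refl with k ≤ᵇ x + k | ≤⇒≤ᵇ (m≤n+m k x)
...   | true | _ = there (here (sym (m+n∸n≡m x k)))

knightMoves : Cell → List Cell
knightMoves (i , j) = cartesianProduct (atDistance 1 i) (atDistance 2 j)
                   ++ cartesianProduct (atDistance 2 i) (atDistance 1 j)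

∈-knightMoves : ∀ {c d} → KnightMove c d → d ∈ knightMoves c
∈-knightMoves (inj₁ (e₁ , e₂)) =
  ∈-++⁺ˡ (∈-cartesianProduct⁺ (∈-atDistance e₁) (∈-atDistance e₂))
∈-knightMoves {i , j} (inj₂ (e₁ , e₂)) =
  ∈-++⁺ʳ (cartesianProduct (atDistance 1 i) (atDistance 2 j))
         (∈-cartesianProduct⁺ (∈-atDistance e₁) (∈-atDistance e₂))

closedSide⇒< : ∀ {e i x a n} → T (e ∨ (i + 2 <ᵇ a)) → (T e → a ≡ n) →
               ∣ i - x ∣ ≤ 2 → x < n → x < a
closedSide⇒< {true}              _ a≡n _ x<n rewrite a≡n _ = x<n
closedSide⇒< {false} {i} {x} {a} t _   d _   =
  ≤-<-trans (≤-trans (m≤n+∣n-m∣ x i) (+-monoʳ-≤ i d)) (<ᵇ⇒< (i + 2) a t)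

module KnightWindow (a b : ℕ) (fullWidth fullHeight : Bool) where

  InWindow : Cell → Set
  InWindow (x , y) = x < a × y < b

  inWindow? : ∀ c → Dec (InWindow c)
  inWindow? (x , y) = (x <? a) ×-dec (y <? b)

  neighbours : Cell → List Cell
  neighbours c = filter (λ d → knightMove? c d ×-dec inWindow? d) (knightMoves c)

  ∈-neighbours⁺ : ∀ {c d} → KnightMove c d → InWindow d → d ∈ neighbours c
  ∈-neighbours⁺ {c} cd wd =
    ∈-filter⁺ (λ d → knightMove? c d ×-dec inWindow? d) (∈-knightMoves cd) (cd , wd)

  ∈-neighbours⁻ : ∀ {c d} → d ∈ neighbours c → KnightMove c d × InWindow d
  ∈-neighbours⁻ {c} d∈ =
    proj₂ (∈-filter⁻ (λ d → knightMove? c d ×-dec inWindow? d) {xs = knightMoves c} d∈)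

  -- All board neighbours of a closed cell lie in the window: the window spans
  -- the board in that direction, or the cell is 3 away from its far edge.
  closed : Cell → Bool
  closed (x , y) = (fullWidth ∨ (x + 2 <ᵇ a)) ∧ (fullHeight ∨ (y + 2 <ᵇ b))

  open ExactlyOneSearch _≟ᶜ_ neighbours closed public

  layer : ℕ → List Cell
  layer k = filter (λ c → proj₁ c ⊔ proj₂ c ≟ k) (cartesianProduct (upTo a) (upTo b))

  -- Going through the window layer by layer lets the search settle the
  -- corner before it branches on distant cells.
  cells : List Cell
  cells = concatMap layer (upTo (a + b))

  ∈-cells : ∀ {c} → InWindow c → c ∈ cells
  ∈-cells {x , y} (x<a , y<b) = ∈-concatMap⁺ layer (lose x⊔y∈ c∈layer)
    where
    x⊔y∈ : x ⊔ y ∈ upTo (a + b)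
    x⊔y∈ = ∈-upTo⁺ (≤-<-trans (m⊔n≤m+n x y) (+-mono-< x<a y<b))
    c∈layer : (x , y) ∈ layer (x ⊔ y)
    c∈layer = ∈-filter⁺ (λ c → proj₁ c ⊔ proj₂ c ≟ x ⊔ y)
                        (∈-cartesianProduct⁺ (∈-upTo⁺ x<a) (∈-upTo⁺ y<b)) refl

  allForced : Bool
  allForced = forced unassigned cells

data BoardSide : ℕ → Set where
  five   : BoardSide 5
  six    : BoardSide 6
  seven+ : ∀ k → BoardSide (7 + k)

boardSide : ∀ {n} → 5 ≤ n → BoardSide n
boardSide (s≤s (s≤s (s≤s (s≤s (s≤s (z≤n {k})))))) = side k
  where
  side : ∀ k → BoardSide (5 + k)
  side zero          = five
  side (suc zero)    = six
  side (suc (suc k)) = seven+ k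

windowLength : ∀ {n} → BoardSide n → ℕ
windowLength five       = 5
windowLength six        = 6
windowLength (seven+ _) = 7

spansBoard : ∀ {n} → BoardSide n → Bool
spansBoard five       = true
spansBoard six        = true
spansBoard (seven+ _) = false

windowLength≤ : ∀ {n} (s : BoardSide n) → windowLength s ≤ n
windowLength≤ five       = ≤-refl
windowLength≤ six        = ≤-refl
windowLength≤ (seven+ k) = m≤m+n 7 k

spansBoard⇒≡ : ∀ {n} (s : BoardSide n) → T (spansBoard s) → windowLength s ≡ n
spansBoard⇒≡ five _ = refl
spansBoard⇒≡ six  _ = refl

5≤windowLength : ∀ {n} (s : BoardSide n) → 5 ≤ windowLength s
5≤windowLength five       = ≤-refl
5≤windowLength six        = n≤1+n 5
5≤windowLength (seven+ _) = ≤-trans (n≤1+n 5) (n≤1+n 6)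

allForced≡true : ∀ {n m} (s : BoardSide n) (t : BoardSide m) →
  KnightWindow.allForced (windowLength s) (windowLength t) (spansBoard s) (spansBoard t) ≡ true
allForced≡true five       five       = refl
allForced≡true five       six        = refl
allForced≡true five       (seven+ _) = refl
allForced≡true six        five       = refl
allForced≡true six        six        = refl
allForced≡true six        (seven+ _) = refl
allForced≡true (seven+ _) five       = refl
allForced≡true (seven+ _) six        = refl
allForced≡true (seven+ _) (seven+ _) = refl

module PerfectDominatingSet {n m : ℕ} (S : VSet n m) (pd : IsPerfectDominating S) where

  ∈-squares : ∀ u → u ∈ squares n m
  ∈-squares (i , j) = ∈-cartesianProduct⁺ (∈-allFin i) (∈-allFin j)

  ∈-neighboursIn : ∀ {v u} → KnightAdj v u → S u ≡ true → u ∈ neighboursIn S v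
  ∈-neighboursIn {v} {u} vu Su =
    ∈-filter⁺ (λ w → knightAdj? v w ×-dec (S w ≟ᵇ true)) (∈-squares u) (vu , Su)

  dominator-unique : ∀ {v u w} → S v ≡ false → KnightAdj v u → KnightAdj v w →
                     S u ≡ true → S w ≡ true → u ≡ w
  dominator-unique {v} v∉ vu vw Su Sw =
    length≡1⇒≡ {xs = neighboursIn S v} (pd v v∉)
               (∈-neighboursIn {v} vu Su) (∈-neighboursIn {v} vw Sw)

  dominator : ∀ {v} → S v ≡ false → ∃ λ u → KnightAdj v u × S u ≡ true
  dominator {v} v∉ with u , u∈ ← length≡1⇒∃∈ {xs = neighboursIn S v} (pd v v∉) =
    u , proj₂ (∈-filter⁻ (λ w → knightAdj? v w ×-dec (S w ≟ᵇ true)) {xs = squares n m} u∈)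

  OnBoard : Cell → Set
  OnBoard (x , y) = x < n × y < m

  onBoard? : ∀ c → Dec (OnBoard c)
  onBoard? (x , y) = (x <? n) ×-dec (y <? m)

  coords : Square n m → Cell
  coords (i , j) = toℕ i , toℕ j

  onBoard-coords : ∀ u → OnBoard (coords u)
  onBoard-coords (i , j) = toℕ<n i , toℕ<n j

  toSquare : ∀ {c} → OnBoard c → Square n m
  toSquare (x<n , y<m) = fromℕ< x<n , fromℕ< y<m

  onBoard-view : ∀ {c} → OnBoard c → ∃ λ u → coords u ≡ c
  onBoard-view (x<n , y<m) =
    toSquare (x<n , y<m) , cong₂ _,_ (toℕ-fromℕ< x<n) (toℕ-fromℕ< y<m)

  -- Cells off the board count as members, so a cell outside inS is a genuine
  -- square outside S.
  inS : Cell → Bool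
  inS c with onBoard? c
  ... | yes b = S (toSquare b)
  ... | no _  = true

  inS-coords : ∀ u → inS (coords u) ≡ S u
  inS-coords (i , j) with onBoard? (toℕ i , toℕ j)
  ... | yes _ = cong₂ (λ i′ j′ → S (i′ , j′)) (fromℕ<-toℕ i (toℕ<n i)) (fromℕ<-toℕ j (toℕ<n j))
  ... | no ¬b = contradiction (onBoard-coords (i , j)) ¬b

  inS-coords⁻ : ∀ u {b} → inS (coords u) ≡ b → S u ≡ b
  inS-coords⁻ u = trans (sym (inS-coords u))

  inS≡false⇒OnBoard : ∀ {c} → inS c ≡ false → OnBoard c
  inS≡false⇒OnBoard {c} c∉ with onBoard? c
  inS≡false⇒OnBoard {c} c∉ | yes b = b
  inS≡false⇒OnBoard {c} () | no _

  inS-atMostOne : ∀ {c p q} → inS c ≡ false → OnBoard p → OnBoard q →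
                  KnightMove c p → KnightMove c q → inS p ≡ true → inS q ≡ true → p ≡ q
  inS-atMostOne c∉ bp bq cp cq p∈ q∈
    with v , refl ← onBoard-view (inS≡false⇒OnBoard c∉)
       | u , refl ← onBoard-view bp
       | w , refl ← onBoard-view bq
    = cong coords (dominator-unique {v} (inS-coords⁻ v c∉) cp cq
                                    (inS-coords⁻ u p∈) (inS-coords⁻ w q∈))

  inS-dominated : ∀ {c} → inS c ≡ false →
                  ∃ λ p → OnBoard p × KnightMove c p × inS p ≡ true
  inS-dominated c∉
    with v , refl     ← onBoard-view (inS≡false⇒OnBoard c∉)
    with u , vu , Su  ← dominator {v} (inS-coords⁻ v c∉)
    = coords u , onBoard-coords u , vu , trans (inS-coords u) Su

  inS-spread : ∀ {c p q} → KnightMove c p → KnightMove c q → p ≢ q →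
               (OnBoard c → OnBoard p × OnBoard q) →
               inS p ≡ true → inS q ≡ true → inS c ≡ true
  inS-spread {c} cp cq p≢q bounds p∈ q∈ with inS c in c∈
  ... | true  = refl
  ... | false with bp , bq ← bounds (inS≡false⇒OnBoard c∈) =
    contradiction (inS-atMostOne c∈ bp bq cp cq p∈ q∈) p≢q

  module _ {a b : ℕ} {fullWidth fullHeight : Bool} (a≤n : a ≤ n) (b≤m : b ≤ m)
           (fullWidth⇒ : T fullWidth → a ≡ n) (fullHeight⇒ : T fullHeight → b ≡ m) where
    open KnightWindow a b fullWidth fullHeight

    inWindow⇒OnBoard : ∀ {c} → InWindow c → OnBoard c
    inWindow⇒OnBoard (x<a , y<b) = <-≤-trans x<a a≤n , <-≤-trans y<b b≤m

    closed⇒InWindow : ∀ {c p} → T (closed c) → KnightMove c p → OnBoard p → InWindow p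
    closed⇒InWindow {i , j} {x , y} cl cp (x<n , y<m)
      with cl₁ , cl₂ ← T-∧⁻ {fullWidth ∨ (i + 2 <ᵇ a)} cl
         | d₁ , d₂   ← knightMove⇒∣-∣≤2 {i} {j} {x} {y} cp
      = closedSide⇒< cl₁ fullWidth⇒ d₁ x<n , closedSide⇒< cl₂ fullHeight⇒ d₂ y<m

    satisfies : Satisfies inS
    satisfies c c∉ = atMostOne , atLeastOne
      where
      atMostOne : AtMostOne inS (neighbours c)
      atMostOne p∈N q∈N
        with cp , wp ← ∈-neighbours⁻ {c} p∈N | cq , wq ← ∈-neighbours⁻ {c} q∈N
        = inS-atMostOne c∉ (inWindow⇒OnBoard wp) (inWindow⇒OnBoard wq) cp cq
      atLeastOne : T (closed c) → Any (λ x → inS x ≡ true) (neighbours c)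
      atLeastOne cl with p , bp , cp , p∈ ← inS-dominated c∉ =
        lose (∈-neighbours⁺ {c} cp (closed⇒InWindow cl cp bp)) p∈

    inS-window : allForced ≡ true → All (λ c → inS c ≡ true) cells
    inS-window all≡true = forced-sound satisfies cells (λ ()) (Equivalence.from T-≡ all≡true)

  module _ (5≤n : 5 ≤ n) (5≤m : 5 ≤ m) where

    _◁_ : Cell → Cell → Set
    (x , y) ◁ (x′ , y′) = (x ≤ x′ ⊎ T (x <ᵇ 5)) × (y ≤ y′ ⊎ T (y <ᵇ 5))

    ◁-onBoard : ∀ {p c} → p ◁ c → OnBoard c → OnBoard p
    ◁-onBoard (bx , by) (x′<n , y′<m) = bound bx 5≤n x′<n , bound by 5≤m y′<m
      where
      bound : ∀ {z z′ k} → z ≤ z′ ⊎ T (z <ᵇ 5) → 5 ≤ k → z′ < k → z < k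
      bound (inj₁ z≤z′) _   z′<k = ≤-<-trans z≤z′ z′<k
      bound (inj₂ z<5)  5≤k _    = <-≤-trans (<ᵇ⇒< _ 5 z<5) 5≤k

    spread : ∀ {c p q} → KnightMove c p → KnightMove c q → p ≢ q → p ◁ c → q ◁ c →
             inS p ≡ true → inS q ≡ true → inS c ≡ true
    spread cp cq p≢q p◁c q◁c =
      inS-spread cp cq p≢q (λ b → ◁-onBoard p◁c b , ◁-onBoard q◁c b)

    Row : ℕ → Set
    Row y = ∀ x → T (x <ᵇ 5) → inS (x , y) ≡ true

    -- (x , 2 + y) is a knight move away from (x ∓ 1 , y) and (x ∓ 2 , 1 + y),
    -- and for each x < 5 two of these lie in the strip.
    rowStep : ∀ y → Row y → Row (1 + y) → Row (2 + y)
    rowStep y r₀ r₁ 0 _ =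
      spread (inj₁ (refl , ∣m+n-n∣≡m 2 y)) (inj₂ (refl , ∣m+n-n∣≡m 1 y)) (λ ())
             (inj₂ _ , inj₁ (m≤n+m y 2)) (inj₂ _ , inj₁ (m≤n+m (1 + y) 1))
             (r₀ 1 _) (r₁ 2 _)
    rowStep y r₀ r₁ 1 _ =
      spread (inj₁ (refl , ∣m+n-n∣≡m 2 y)) (inj₁ (refl , ∣m+n-n∣≡m 2 y)) (λ ())
             (inj₂ _ , inj₁ (m≤n+m y 2)) (inj₂ _ , inj₁ (m≤n+m y 2))
             (r₀ 0 _) (r₀ 2 _)
    rowStep y r₀ r₁ 2 _ =
      spread (inj₁ (refl , ∣m+n-n∣≡m 2 y)) (inj₁ (refl , ∣m+n-n∣≡m 2 y)) (λ ())
             (inj₂ _ , inj₁ (m≤n+m y 2)) (inj₂ _ , inj₁ (m≤n+m y 2))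
             (r₀ 1 _) (r₀ 3 _)
    rowStep y r₀ r₁ 3 _ =
      spread (inj₁ (refl , ∣m+n-n∣≡m 2 y)) (inj₁ (refl , ∣m+n-n∣≡m 2 y)) (λ ())
             (inj₂ _ , inj₁ (m≤n+m y 2)) (inj₂ _ , inj₁ (m≤n+m y 2))
             (r₀ 2 _) (r₀ 4 _)
    rowStep y r₀ r₁ 4 _ =
      spread (inj₁ (refl , ∣m+n-n∣≡m 2 y)) (inj₂ (refl , ∣m+n-n∣≡m 1 y)) (λ ())
             (inj₂ _ , inj₁ (m≤n+m y 2)) (inj₂ _ , inj₁ (m≤n+m (1 + y) 1))
             (r₀ 3 _) (r₁ 2 _)

    Column : ℕ → Set
    Column x = ∀ y → inS (x , y) ≡ true

    -- (2 + x , y) is a knight move away from (x , y ± 1) and (1 + x , y ± 2).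
    columnStep : ∀ x → Column x → Column (1 + x) → Column (2 + x)
    columnStep x c₀ c₁ 0 =
      spread (inj₂ (∣m+n-n∣≡m 2 x , refl)) (inj₁ (∣m+n-n∣≡m 1 x , refl)) (λ ())
             (inj₁ (m≤n+m x 2) , inj₂ _) (inj₁ (m≤n+m (1 + x) 1) , inj₂ _)
             (c₀ 1) (c₁ 2)
    columnStep x c₀ c₁ 1 =
      spread (inj₂ (∣m+n-n∣≡m 2 x , refl)) (inj₁ (∣m+n-n∣≡m 1 x , refl)) (λ ())
             (inj₁ (m≤n+m x 2) , inj₂ _) (inj₁ (m≤n+m (1 + x) 1) , inj₂ _)
             (c₀ 0) (c₁ 3)
    columnStep x c₀ c₁ (suc (suc y)) =
      spread (inj₂ (∣m+n-n∣≡m 2 x , ∣m+n-n∣≡m 1 y)) (inj₁ (∣m+n-n∣≡m 1 x , ∣m+n-n∣≡m 2 y)) (λ ())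
             (inj₁ (m≤n+m x 2) , inj₁ (m≤n+m (1 + y) 1)) (inj₁ (m≤n+m (1 + x) 1) , inj₁ (m≤n+m y 2))
             (c₀ (1 + y)) (c₁ y)

    inS-everywhere : Row 0 → Row 1 → ∀ c → inS c ≡ true
    inS-everywhere r₀ r₁ (x , y) = induction₂ (column 0 _) (column 1 _) columnStep x y
      where
      column : ∀ x → T (x <ᵇ 5) → Column x
      column x x<5 y = induction₂ r₀ r₁ rowStep y x x<5

    S-full : ∀ u → S u ≡ true
    S-full u = inS-coords⁻ u (inS-everywhere (cornerRow 0 _) (cornerRow 1 _) (coords u))
      where
      sn = boardSide 5≤n
      sm = boardSide 5≤m
      open KnightWindow (windowLength sn) (windowLength sm) (spansBoard sn) (spansBoard sm)
        using (cells; ∈-cells)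
      window : All (λ c → inS c ≡ true) cells
      window = inS-window (windowLength≤ sn) (windowLength≤ sm)
                          (spansBoard⇒≡ sn) (spansBoard⇒≡ sm) (allForced≡true sn sm)
      cornerRow : ∀ y → T (y <ᵇ 5) → Row y
      cornerRow y y<5 x x<5 =
        All.lookup window (∈-cells ( <-≤-trans (<ᵇ⇒< x 5 x<5) (5≤windowLength sn)
                                   , <-≤-trans (<ᵇ⇒< y 5 y<5) (5≤windowLength sm)))

card-full : ∀ {n m} (S : VSet n m) → (∀ u → S u ≡ true) → card S ≡ n * m
card-full {n} {m} S all-in = begin
  length (filter (λ v → S v ≟ᵇ true) (squares n m))
    ≡⟨ cong length (filter-all (λ v → S v ≟ᵇ true) {xs = squares n m}
                               (All.tabulate (λ {u} _ → all-in u))) ⟩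
  length (squares n m)
    ≡⟨ length-cartesianProduct (allFin n) (allFin m) ⟩
  length (allFin n) * length (allFin m)
    ≡⟨ cong₂ _*_ (length-tabulate {n = n} (λ i → i)) (length-tabulate {n = m} (λ i → i)) ⟩
  n * m ∎
  where open ≡-Reasoning

theorem2p1 : (n m : ℕ) → 5 ≤ n → 5 ≤ m →
    IsPerfectDominationNumber n m (n * m)
theorem2p1 n m 5≤n 5≤m =
  ((λ _ → true) , (λ _ ()) , card-full {n} {m} (λ _ → true) (λ _ → refl)) ,
  λ S pd → ≤-reflexive (sym (card-full S (PerfectDominatingSet.S-full S pd 5≤n 5≤m)))
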